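{- Let $\mathbf A$ be a finite idempotent algebra with a WNU term operation, and let $\delta$ be a bridge from $0_{\mathbf A}$ to $0_{\mathbf A}$ such that $\mathrm{proj}_{1,2}(\delta)\subseteq\widetilde\delta$ and $\mathrm{proj}_{1,2}(\delta)$ is linked. Then $\mathbf A$ is BA and center free.
   Context: $0_{\mathbf A}$ is the equality relation on $A$. A bridge from $0_{\mathbf A}$ to $0_{\mathbf A}$ is a subalgebra $\delta\le\mathbf A^4$ such that $\mathrm{proj}_{1,2}(\delta)\supsetneq0_{\mathbf A}$, $\mathrm{proj}_{3,4}(\delta)\supsetneq 0_{\mathbf A}$, and $(a_1,a_2,a_3,a_4)\in\delta$ implies ($a_1=a_2\iff a_3=a_4$); $\widetilde\delta=\{(x,y)\mid(x,x,y,y)\in\delta\}$. A binary subdirect relation $\rho\subseteq X\times Y$ is linked if the bipartite graph on $X\sqcup Y$ with edges given by $\rho$ is connected. A subuniverse $B\le\mathbf A$ is absorbing if some term operation $t$ satisfies $t(B,\dots,B,A,B,\dots,B)\subseteq B$ for every position of $A$; binary absorbing (BA) if $t$ can be chosen binary; central if it is absorbing and for every $a\in A\setminus B$, $(a,a)\notin\mathrm{Sg}_{\mathbf A}((\{a\}\times B)\cup(B\times\{a\}))$ (the subalgebra of $\mathbf A^2$ generated). $\mathbf A$ is BA and center free if it has no proper nonempty binary absorbing subuniverse and no proper nonempty central subuniverse. -}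

module Defs where

open import Data.Nat using (ℕ; _≥_)
open import Data.Fin using (Fin; _≟_)
open import Data.Bool using (Bool; T; if_then_else_)
open import Data.Product using (Σ; ∃; _×_; _,_; proj₁; proj₂)
open import Data.Sum using (_⊎_; inj₁; inj₂)
open import Data.Fin.Subset using (Subset; _∈_; _∉_)
open import Relation.Nullary using (¬_; does)
open import Relation.Binary.PropositionalEquality using (_≡_; _≢_)
open import Relation.Binary.Construct.Closure.ReflexiveTransitive using (Star)
open import Relation.Binary.Construct.Closure.Symmetric using (SymClosure)
open import Function.Bundles using (_⇔_)
open import Data.Empty using (⊥)

record Algebra : Set₁ where
  field
    size  : ℕ
    Op    : Set
    arity : Op → ℕ
    op    : (f : Op) → (Fin (arity f) → Fin size) → Fin size

module _ (𝐀 : Algebra) where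
  open Algebra 𝐀

  Carrier : Set
  Carrier = Fin size

  data Term (X : Set) : Set where
    var  : X → Term X
    node : (f : Op) → (Fin (arity f) → Term X) → Term X

  eval : {X : Set} → Term X → (X → Carrier) → Carrier
  eval (var x)       ρ = ρ x
  eval (node f ts)   ρ = op f (λ j → eval (ts j) ρ)

  Idempotent : Set
  Idempotent = ∀ (f : Op) (a : Carrier) → op f (λ _ → a) ≡ a

  oneAt : {m : ℕ} → Carrier → Carrier → Fin m → (Fin m → Carrier)
  oneAt x y i j = if does (j ≟ i) then y else x

  -- w is a WNU term operation (arity m ≥ 2, idempotency is inherited from the algebra)
  IsWNU : {m : ℕ} → Term (Fin m) → Set
  IsWNU {m} w = ∀ (x y : Carrier) (i j : Fin m) →
    eval w (oneAt x y i) ≡ eval w (oneAt x y j)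

  HasWNU : Set
  HasWNU = Σ ℕ λ m → m ≥ 2 × Σ (Term (Fin m)) IsWNU

  IsSubuniverse : Subset size → Set
  IsSubuniverse B = ∀ (f : Op) (as : Fin (arity f) → Carrier) →
    (∀ j → as j ∈ B) → op f as ∈ B

  AbsorbsBy : Subset size → {k : ℕ} → Term (Fin k) → Set
  AbsorbsBy B {k} t = ∀ (i : Fin k) (as : Fin k → Carrier) →
    (∀ j → j ≢ i → as j ∈ B) → eval t as ∈ B

  IsAbsorbing : Subset size → Set
  IsAbsorbing B = IsSubuniverse B × Σ ℕ λ k → Σ (Term (Fin k)) (AbsorbsBy B)

  IsBinaryAbsorbing : Subset size → Set
  IsBinaryAbsorbing B = IsSubuniverse B × Σ (Term (Fin 2)) (AbsorbsBy B)

  data Sg² (G : Carrier × Carrier → Set) : Carrier × Carrier → Set where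
    gen : ∀ {p} → G p → Sg² G p
    app : (f : Op) (ps : Fin (arity f) → Carrier × Carrier) →
          (∀ j → Sg² G (ps j)) →
          Sg² G (op f (λ j → proj₁ (ps j)) , op f (λ j → proj₂ (ps j)))

  crossGen : Carrier → Subset size → Carrier × Carrier → Set
  crossGen a B (x , y) = (x ≡ a × y ∈ B) ⊎ (x ∈ B × y ≡ a)

  IsCentral : Subset size → Set
  IsCentral B = IsAbsorbing B ×
    (∀ (a : Carrier) → a ∉ B → ¬ Sg² (crossGen a B) (a , a))

  Nonempty : Subset size → Set
  Nonempty B = ∃ λ a → a ∈ B

  Proper : Subset size → Set
  Proper B = ¬ (∀ a → a ∈ B)

  BAandCenterFree : Set
  BAandCenterFree =
    (∀ B → ¬ (Nonempty B × Proper B × IsBinaryAbsorbing B)) ×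
    (∀ B → ¬ (Nonempty B × Proper B × IsCentral B))

  Rel4 : Set
  Rel4 = Carrier → Carrier → Carrier → Carrier → Bool

  IsSubalgebra4 : Rel4 → Set
  IsSubalgebra4 δ = ∀ (f : Op) (a b c d : Fin (arity f) → Carrier) →
    (∀ j → T (δ (a j) (b j) (c j) (d j))) →
    T (δ (op f a) (op f b) (op f c) (op f d))

  proj₁₂ : Rel4 → Carrier → Carrier → Set
  proj₁₂ δ a b = ∃ λ c → ∃ λ d → T (δ a b c d)

  proj₃₄ : Rel4 → Carrier → Carrier → Set
  proj₃₄ δ c d = ∃ λ a → ∃ λ b → T (δ a b c d)

  -- ρ strictly contains the equality relation 0_A
  StrictlyAboveZero : (Carrier → Carrier → Set) → Set
  StrictlyAboveZero ρ = (∀ a → ρ a a) × (∃ λ a → ∃ λ b → a ≢ b × ρ a b)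

  IsBridge00 : Rel4 → Set
  IsBridge00 δ = IsSubalgebra4 δ ×
    StrictlyAboveZero (proj₁₂ δ) ×
    StrictlyAboveZero (proj₃₄ δ) ×
    (∀ a₁ a₂ a₃ a₄ → T (δ a₁ a₂ a₃ a₄) → (a₁ ≡ a₂ ⇔ a₃ ≡ a₄))

  δ̃ : Rel4 → Carrier → Carrier → Set
  δ̃ δ x y = T (δ x x y y)

  -- bipartite graph on A ⊔ A with edges from ρ
  Edge : (Carrier → Carrier → Set) → Carrier ⊎ Carrier → Carrier ⊎ Carrier → Set
  Edge ρ (inj₁ a) (inj₂ b) = ρ a b
  Edge ρ _        _        = ⊥

  Linked : (Carrier → Carrier → Set) → Set
  Linked ρ = ∀ (u v : Carrier ⊎ Carrier) → Star (SymClosure (Edge ρ)) u v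

{-# OPTIONS --safe #-}
module Submission where

-- Write ρ for proj₁₂ δ. As ρ ⊆ δ̃, every column (c, c, d, d) with c ρ d lies in δ, so for a term s
-- the bridge property turns s(c[i ≔ p]) = s(c[i ≔ q]) into s(d[i ≔ u]) = s(d[i ≔ v]) whenever
-- (p, q, u, v) ∈ δ and c ρ d pointwise. As ρ is reflexive and linked, an equality
-- s(c[i ≔ p]) = s(c[i ≔ q]) with p, q joined by a ρ-edge therefore holds in every context c.
--
-- By linkedness a proper nonempty B contains an a joined by a ρ-edge to some b ∉ B. Substituting an
-- absorbing term s into its own i-th argument until y ↦ s(a, …, a, y, a, …, a) becomes idempotent
-- at b yields e ∈ B, joined to b by a ρ-edge, that can replace b at position i in every context.
-- Repeating this at every position gives an absorbing s with such an eᵢ at each i. For binary s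
-- this forces b = s(e₀, b) ∈ B; in general (b, b) = s((b, e₀), …, (b, eₖ₋₁)) lies in the
-- subalgebra generated by {b} × B, so B is not central.

open import Defs
open import Data.Product using (_×_; ∃; ∃₂; _,_; proj₁; proj₂)
open import Data.Nat using (ℕ; zero; suc; _+_; _*_; _∸_)
open import Data.Nat.Properties
  using (n<1+n; n≤1+n; +-comm; ≤-trans; m≤m*n; m∸n+n≡m; m≤n⇒∃[o]m+o≡n)
open import Data.Fin using (Fin; zero; suc; toℕ; _≟_)
open import Data.Fin.Properties using (pigeonhole; ¬∀⟶∃¬)
open import Data.Fin.Subset using (Subset; _∈_; _∉_)
open import Data.Fin.Subset.Properties using (_∈?_)
open import Data.Vec.Functional using (Vector; updateAt; _∷_; tail)
open import Data.Vec.Functional.Properties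
  using (updateAt-updates; updateAt-minimal; updateAt-id-local; updateAt-updateAt; updateAt-commutes;
         map-updateAt-local)
open import Data.List using (List; []; allFin) renaming (_∷_ to _∷ₗ_)
open import Data.List.Relation.Unary.Any using (here; there)
open import Data.List.Membership.Propositional using () renaming (_∈_ to _∈ₗ_)
open import Data.List.Membership.Propositional.Properties using (∈-allFin)
open import Data.Sum using (inj₁; inj₂; reduce)
open import Data.Bool using (T)
open import Data.Empty using (⊥-elim)
open import Function using (_∘_; const; id; _⇔_; mk⇔; Equivalence)
import Function.Properties.Equivalence as ⇔
import Function.Endo.Propositional as Endo
open import Relation.Nullary using (¬_; yes; no; contradiction)
open import Relation.Unary using (Decidable)
open import Relation.Binary using (Reflexive)
open import Relation.Binary.Definitions using (_Respects_)
open import Relation.Binary.PropositionalEquality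
open import Relation.Binary.Construct.Closure.ReflexiveTransitive as Star using (Star; ε; _◅_)
open import Relation.Binary.Construct.Closure.Symmetric as SymClosure using (SymClosure; fwd; bwd)

infixl 6 _[_]≔_

_[_]≔_ : ∀ {A : Set} {n} → Vector A n → Fin n → A → Vector A n
E [ i ]≔ x = updateAt E i (const x)

module _ {A B : Set} {R : A → B → Set} where

  ≔-pointwise : ∀ {n} {E : Vector A n} {E' : Vector B n} (i : Fin n) {x y} →
                (∀ j → R (E j) (E' j)) → R x y → ∀ j → R ((E [ i ]≔ x) j) ((E' [ i ]≔ y) j)
  ≔-pointwise zero    R-EE' Rxy zero    = Rxy
  ≔-pointwise zero    R-EE' Rxy (suc j) = R-EE' (suc j)
  ≔-pointwise (suc i) R-EE' Rxy zero    = R-EE' zero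
  ≔-pointwise (suc i) R-EE' Rxy (suc j) = ≔-pointwise i (R-EE' ∘ suc) Rxy j

module _ {A : Set} where

  ≔-elim : ∀ (P : A → Set) {n} {E : Vector A n} {i : Fin n} {x} j →
           (j ≡ i → P x) → (j ≢ i → P (E j)) → P ((E [ i ]≔ x) j)
  ≔-elim P {E = E} {i} j at-i elsewhere with j ≟ i
  ... | yes refl = subst P (sym (updateAt-updates j E)) (at-i refl)
  ... | no j≢i   = subst P (sym (updateAt-minimal j i E j≢i)) (elsewhere j≢i)

  hybrid : ∀ {n} (R : Fin n → A → A → Set) (Q : Vector A n → Set) → Q Respects _≗_ →
           (∀ E l {x y} → R l x y → Q (E [ l ]≔ x) → Q (E [ l ]≔ y)) →
           ∀ E E' → (∀ l → R l (E l) (E' l)) → Q E → Q E'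
  hybrid {zero}  R Q resp step E E' R-EE' QE = resp (λ ()) QE
  hybrid {suc n} R Q resp step E E' R-EE' QE =
    resp (λ { zero → refl ; (suc _) → refl })
      (hybrid (R ∘ suc) (Q ∘ (E' zero ∷_)) (resp ∘ ∷-cong) step-tail (tail E) (tail E') (R-EE' ∘ suc)
        (resp (λ { zero → refl ; (suc _) → refl })
          (step E zero (R-EE' zero) (resp (λ { zero → refl ; (suc _) → refl }) QE))))
    where
    ∷-cong : ∀ {G G'} → G ≗ G' → (E' zero ∷ G) ≗ (E' zero ∷ G')
    ∷-cong G≗G' zero    = refl
    ∷-cong G≗G' (suc j) = G≗G' j

    step-tail : ∀ G l {x y} → R (suc l) x y → Q (E' zero ∷ (G [ l ]≔ x)) → Q (E' zero ∷ (G [ l ]≔ y))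
    step-tail G l Rxy =
      resp (λ { zero → refl ; (suc _) → refl }) ∘ step (E' zero ∷ G) (suc l) Rxy
        ∘ resp (λ { zero → refl ; (suc _) → refl })

  module _ (R : A → A → Set) (R-refl : Reflexive R) (connected : ∀ x y → Star (SymClosure R) x y) where

    pointwise-invariant⇒constant : ∀ {n} (Q : Vector A n → Set) → Q Respects _≗_ →
      (∀ {E E'} → (∀ j → R (E j) (E' j)) → Q E ⇔ Q E') → ∀ E E' → Q E → Q E'
    pointwise-invariant⇒constant Q resp invariant E E' =
      hybrid (λ _ → Star (SymClosure R)) Q resp along-path E E' (λ l → connected (E l) (E' l))
      where
      step : ∀ E l {x y} → SymClosure R x y → Q (E [ l ]≔ x) → Q (E [ l ]≔ y)
      step E l (fwd Rxy) = Equivalence.to   (invariant (≔-pointwise {R = R} l (λ _ → R-refl) Rxy))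
      step E l (bwd Ryx) = Equivalence.from (invariant (≔-pointwise {R = R} l (λ _ → R-refl) Ryx))

      along-path : ∀ E l {x y} → Star (SymClosure R) x y → Q (E [ l ]≔ x) → Q (E [ l ]≔ y)
      along-path E l ε          = id
      along-path E l (xz ◅ zy) = along-path E l zy ∘ step E l xz

  boundary-edge : ∀ {R : A → A → Set} {P : A → Set} → Decidable P →
                  ∀ {x y} → Star R x y → P x → ¬ P y → ∃₂ λ a b → P a × ¬ P b × R a b
  boundary-edge P? ε                   Px ¬Py = contradiction Px ¬Py
  boundary-edge P? (_◅_ {j = z} xz zy) Px ¬Py with P? z
  ... | yes Pz  = boundary-edge P? zy Pz ¬Py
  ... | no  ¬Pz = _ , _ , Px , ¬Pz , xz

module _ {n} (f : Fin n → Fin n) where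
  open Endo (Fin n) using (_^_; ^-homo)

  ^-+ : ∀ m k x → (f ^ (m + k)) x ≡ (f ^ m) ((f ^ k) x)
  ^-+ m k x = cong-app (^-homo f m k) x

  ^-*-fixed : ∀ {p y} → (f ^ p) y ≡ y → ∀ q → (f ^ (q * p)) y ≡ y
  ^-*-fixed fix zero = refl
  ^-*-fixed {p} {y} fix (suc q) = begin
    (f ^ (p + q * p)) y       ≡⟨ ^-+ p (q * p) y ⟩
    (f ^ p) ((f ^ (q * p)) y) ≡⟨ cong (f ^ p) (^-*-fixed fix q) ⟩
    (f ^ p) y                 ≡⟨ fix ⟩
    y                         ∎
    where open ≡-Reasoning

  -- The orbit of x enters a cycle of length p after a steps; a multiple of p that is
  -- at least a is the required exponent.
  idempotent-iterate : ∀ x → ∃ λ N → (f ^ suc N) ((f ^ suc N) x) ≡ (f ^ suc N) x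
  idempotent-iterate x
    with i , j , i<j , fⁱx≡fʲx ← pigeonhole (n<1+n n) (λ i → (f ^ toℕ i) x)
    with o , 1+a+o≡j ← m≤n⇒∃[o]m+o≡n i<j
    = o + a * p , (begin
      (f ^ M) ((f ^ M) x)          ≡⟨ cong (f ^ M) c+a≡M ⟨
      (f ^ M) ((f ^ (c + a)) x)    ≡⟨ cong (f ^ M) (^-+ c a x) ⟩
      (f ^ M) ((f ^ c) y)          ≡⟨ ^-+ M c y ⟨
      (f ^ (M + c)) y              ≡⟨ cong (λ m → (f ^ m) y) (+-comm M c) ⟩
      (f ^ (c + M)) y              ≡⟨ ^-+ c M y ⟩
      (f ^ c) ((f ^ M) y)          ≡⟨ cong (f ^ c) (^-*-fixed {p} y-periodic (suc a)) ⟩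
      (f ^ c) y                    ≡⟨ ^-+ c a x ⟨
      (f ^ (c + a)) x              ≡⟨ c+a≡M ⟩
      (f ^ M) x                    ∎)
    where
    open ≡-Reasoning
    a p M c : ℕ
    a = toℕ i
    p = suc o
    M = suc a * p
    c = M ∸ a
    y : Fin n
    y = (f ^ a) x
    c+a≡M : (f ^ (c + a)) x ≡ (f ^ M) x
    c+a≡M = cong (λ m → (f ^ m) x) (m∸n+n≡m (≤-trans (n≤1+n a) (m≤m*n (suc a) p)))
    y-periodic : (f ^ p) y ≡ y
    y-periodic = begin
      (f ^ p) y           ≡⟨ ^-+ p a x ⟨
      (f ^ (p + a)) x     ≡⟨ cong (λ m → (f ^ suc m) x) (+-comm o a) ⟩
      (f ^ (suc a + o)) x ≡⟨ cong (λ m → (f ^ m) x) 1+a+o≡j ⟩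
      (f ^ toℕ j) x       ≡⟨ fⁱx≡fʲx ⟨
      y                   ∎

module Terms (𝐀 : Algebra) where
  open Algebra 𝐀

  ⟦_⟧ : ∀ {X} → Term 𝐀 X → (X → Carrier 𝐀) → Carrier 𝐀
  ⟦_⟧ = eval 𝐀

  _⟪_⟫ : ∀ {X Y} → Term 𝐀 X → (X → Term 𝐀 Y) → Term 𝐀 Y
  var x     ⟪ σ ⟫ = σ x
  node f ts ⟪ σ ⟫ = node f (λ j → ts j ⟪ σ ⟫)

  nest : ∀ {k} → Term 𝐀 (Fin k) → Fin k → ℕ → Term 𝐀 (Fin k)
  nest s j zero    = var j
  nest s j (suc m) = s ⟪ var [ j ]≔ nest s j m ⟫

  Interchangeable : ∀ {k} → Term 𝐀 (Fin k) → Fin k → Carrier 𝐀 → Carrier 𝐀 → Set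
  Interchangeable s l p q = ∀ E → ⟦ s ⟧ (E [ l ]≔ p) ≡ ⟦ s ⟧ (E [ l ]≔ q)

  Extensional : Set
  Extensional = ∀ f {g h} → g ≗ h → op f g ≡ op f h

  eval-preserves₄ : ∀ {δ} → IsSubalgebra4 𝐀 δ → ∀ {X} (t : Term 𝐀 X) {E₁ E₂ E₃ E₄} →
    (∀ x → T (δ (E₁ x) (E₂ x) (E₃ x) (E₄ x))) → T (δ (⟦ t ⟧ E₁) (⟦ t ⟧ E₂) (⟦ t ⟧ E₃) (⟦ t ⟧ E₄))
  eval-preserves₄ δ-sub (var x)     E∈δ = E∈δ x
  eval-preserves₄ {δ} δ-sub (node f ts) E∈δ = δ-sub f _ _ _ _ (λ j → eval-preserves₄ {δ} δ-sub (ts j) E∈δ)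

  eval-preserves-proj₁₂ : ∀ {δ} → IsSubalgebra4 𝐀 δ → ∀ {X} (t : Term 𝐀 X) {E E'} →
    (∀ x → proj₁₂ 𝐀 δ (E x) (E' x)) → proj₁₂ 𝐀 δ (⟦ t ⟧ E) (⟦ t ⟧ E')
  eval-preserves-proj₁₂ {δ} δ-sub t E∈ρ =
    _ , _ , eval-preserves₄ {δ} δ-sub t (λ x → proj₂ (proj₂ (E∈ρ x)))

  eval-preserves-Sg² : ∀ {G} {X} (t : Term 𝐀 X) {E E'} →
    (∀ x → Sg² 𝐀 G (E x , E' x)) → Sg² 𝐀 G (⟦ t ⟧ E , ⟦ t ⟧ E')
  eval-preserves-Sg² (var x)     E∈Sg = E∈Sg x
  eval-preserves-Sg² (node f ts) E∈Sg = app f _ (λ j → eval-preserves-Sg² (ts j) E∈Sg)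

  module _ (ext : Extensional) where

    eval-cong : ∀ {X} (t : Term 𝐀 X) {E E'} → E ≗ E' → ⟦ t ⟧ E ≡ ⟦ t ⟧ E'
    eval-cong (var x)     E≗E' = E≗E' x
    eval-cong (node f ts) E≗E' = ext f (λ j → eval-cong (ts j) E≗E')

    eval-⟪⟫ : ∀ {X Y} (t : Term 𝐀 X) (σ : X → Term 𝐀 Y) E → ⟦ t ⟪ σ ⟫ ⟧ E ≡ ⟦ t ⟧ (λ x → ⟦ σ x ⟧ E)
    eval-⟪⟫ (var x)     σ E = refl
    eval-⟪⟫ (node f ts) σ E = ext f (λ j → eval-⟪⟫ (ts j) σ E)

    eval-const : Idempotent 𝐀 → ∀ {X} (t : Term 𝐀 X) x → ⟦ t ⟧ (const x) ≡ x
    eval-const idem (var _)     x = refl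
    eval-const idem (node f ts) x = trans (ext f (λ j → eval-const idem (ts j) x)) (idem f x)

    eval-const-≔ : Idempotent 𝐀 → ∀ {k} (s : Term 𝐀 (Fin k)) l x → ⟦ s ⟧ (const x [ l ]≔ x) ≡ x
    eval-const-≔ idem s l x = trans (eval-cong s (updateAt-id-local l (const x) refl)) (eval-const idem s x)

    eval-interchangeable : ∀ {k} (s : Term 𝐀 (Fin k)) {E E'} →
      (∀ l → Interchangeable s l (E l) (E' l)) → ⟦ s ⟧ E ≡ ⟦ s ⟧ E'
    eval-interchangeable s {E} {E'} E↔E' =
      hybrid (λ l x y → Interchangeable s l y x) (λ F → ⟦ s ⟧ F ≡ ⟦ s ⟧ E')
        (λ F≗F' → trans (sym (eval-cong s F≗F'))) (λ F l y↔x → trans (y↔x F))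
        E' E E↔E' refl

    module _ {k} (s : Term 𝐀 (Fin k)) (j : Fin k) where

      eval-nest-suc : ∀ m E → ⟦ nest s j (suc m) ⟧ E ≡ ⟦ s ⟧ (E [ j ]≔ ⟦ nest s j m ⟧ E)
      eval-nest-suc m E = trans (eval-⟪⟫ s _ E)
        (eval-cong s (map-updateAt-local {f = λ t → ⟦ t ⟧ E} var j refl))

      open Endo (Carrier 𝐀) using (_^_)

      eval-nest : ∀ m E x → ⟦ nest s j m ⟧ (E [ j ]≔ x) ≡ ((λ y → ⟦ s ⟧ (E [ j ]≔ y)) ^ m) x
      eval-nest zero    E x = updateAt-updates j E
      eval-nest (suc m) E x = begin
        ⟦ nest s j (suc m) ⟧ (E [ j ]≔ x)                           ≡⟨ eval-nest-suc m (E [ j ]≔ x) ⟩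
        ⟦ s ⟧ (E [ j ]≔ x [ j ]≔ ⟦ nest s j m ⟧ (E [ j ]≔ x))      ≡⟨ eval-cong s (updateAt-updateAt j E) ⟩
        ⟦ s ⟧ (E [ j ]≔ ⟦ nest s j m ⟧ (E [ j ]≔ x))                ≡⟨ cong (λ y → ⟦ s ⟧ (E [ j ]≔ y)) (eval-nest m E x) ⟩
        ⟦ s ⟧ (E [ j ]≔ ((λ y → ⟦ s ⟧ (E [ j ]≔ y)) ^ m) x)         ∎
        where open ≡-Reasoning

      nest-interchangeable : ∀ {l p q} → l ≢ j → Interchangeable s l p q →
                             ∀ m → Interchangeable (nest s j m) l p q
      nest-interchangeable {l} l≢j p↔q zero E =
        trans (updateAt-minimal j l E (l≢j ∘ sym)) (sym (updateAt-minimal j l E (l≢j ∘ sym)))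
      nest-interchangeable {l} {p} {q} l≢j p↔q (suc m) E = begin
        ⟦ nest s j (suc m) ⟧ (E [ l ]≔ p)                   ≡⟨ eval-nest-suc m (E [ l ]≔ p) ⟩
        ⟦ s ⟧ (E [ l ]≔ p [ j ]≔ w p)                       ≡⟨ cong (λ y → ⟦ s ⟧ (E [ l ]≔ p [ j ]≔ y)) w-p≡w-q ⟩
        ⟦ s ⟧ (E [ l ]≔ p [ j ]≔ w q)                       ≡⟨ eval-cong s (updateAt-commutes j l (l≢j ∘ sym) E) ⟩
        ⟦ s ⟧ (E [ j ]≔ w q [ l ]≔ p)                       ≡⟨ p↔q (E [ j ]≔ w q) ⟩
        ⟦ s ⟧ (E [ j ]≔ w q [ l ]≔ q)                       ≡⟨ eval-cong s (updateAt-commutes l j l≢j E) ⟩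
        ⟦ s ⟧ (E [ l ]≔ q [ j ]≔ w q)                       ≡⟨ eval-nest-suc m (E [ l ]≔ q) ⟨
        ⟦ nest s j (suc m) ⟧ (E [ l ]≔ q)                   ∎
        where
        open ≡-Reasoning
        w : Carrier 𝐀 → Carrier 𝐀
        w x = ⟦ nest s j m ⟧ (E [ l ]≔ x)
        w-p≡w-q : w p ≡ w q
        w-p≡w-q = nest-interchangeable l≢j p↔q m E

      nest-absorbs : ∀ {B} → AbsorbsBy 𝐀 B s → ∀ m → AbsorbsBy 𝐀 B (nest s j (suc m))
      nest-absorbs {B} s-abs m i E E∈B = subst (_∈ B) (sym (eval-nest-suc m E)) (s-abs i _ (outside-i m))
        where
        nest-∈ : ∀ r → j ≢ i → ⟦ nest s j r ⟧ E ∈ B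
        outside-i : ∀ r j' → j' ≢ i → (E [ j ]≔ ⟦ nest s j r ⟧ E) j' ∈ B
        outside-i r j' j'≢i = ≔-elim (_∈ B) j' (λ { refl → nest-∈ r j'≢i }) (λ _ → E∈B j' j'≢i)
        nest-∈ zero    j≢i = E∈B j j≢i
        nest-∈ (suc r) j≢i = subst (_∈ B) (sym (eval-nest-suc r E)) (s-abs i _ (outside-i r))

module Bridge (𝐀 : Algebra) (idem : Idempotent 𝐀) (δ : Rel4 𝐀) (bridge : IsBridge00 𝐀 δ)
  (ρ⊆δ̃ : ∀ a b → proj₁₂ 𝐀 δ a b → δ̃ 𝐀 δ a b) (linked : Linked 𝐀 (proj₁₂ 𝐀 δ)) where
  open Algebra 𝐀 using (size)
  open Terms 𝐀

  A : Set
  A = Carrier 𝐀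

  ρ : A → A → Set
  ρ = proj₁₂ 𝐀 δ

  δ-sub : IsSubalgebra4 𝐀 δ
  δ-sub = proj₁ bridge

  ρ-refl : Reflexive ρ
  ρ-refl = proj₁ (proj₁ (proj₂ bridge)) _

  bridge-iff : ∀ {a₁ a₂ a₃ a₄} → T (δ a₁ a₂ a₃ a₄) → a₁ ≡ a₂ ⇔ a₃ ≡ a₄
  bridge-iff = proj₂ (proj₂ (proj₂ bridge)) _ _ _ _

  -- Without function extensionality an operation need not respect pointwise equality
  -- of its arguments; the bridge property forces it.
  ext : Extensional
  ext f {g} {h} g≗h = Equivalence.from (bridge-iff (δ-sub f g h g g columns)) refl
    where
    columns : ∀ j → T (δ (g j) (h j) (g j) (g j))
    columns j = subst (λ z → T (δ (g j) z (g j) (g j))) (g≗h j) (ρ⊆δ̃ _ _ ρ-refl)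

  connected : ∀ x y → Star (SymClosure ρ) x y
  connected x y =
    Star.gmap reduce (SymClosure.gmap reduce (λ {u} {v} → edge⇒ρ {u} {v})) (linked (inj₁ x) (inj₁ y))
    where
    edge⇒ρ : ∀ {u v} → Edge 𝐀 ρ u v → ρ (reduce u) (reduce v)
    edge⇒ρ {inj₁ _} {inj₂ _} uv = uv

  δ-columns : ∀ {n} {E E' : Vector A n} i {p q u v} → T (δ p q u v) → (∀ j → ρ (E j) (E' j)) →
    ∀ j → T (δ ((E [ i ]≔ p) j) ((E [ i ]≔ q) j) ((E' [ i ]≔ u) j) ((E' [ i ]≔ v) j))
  δ-columns zero    pquv E-ρ-E' zero    = pquv
  δ-columns zero    pquv E-ρ-E' (suc j) = ρ⊆δ̃ _ _ (E-ρ-E' (suc j))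
  δ-columns (suc i) pquv E-ρ-E' zero    = ρ⊆δ̃ _ _ (E-ρ-E' zero)
  δ-columns (suc i) pquv E-ρ-E' (suc j) = δ-columns i pquv (E-ρ-E' ∘ suc) j

  module _ {k} (s : Term 𝐀 (Fin k)) (i : Fin k) where

    Agree : A → A → Vector A k → Set
    Agree p q E = ⟦ s ⟧ (E [ i ]≔ p) ≡ ⟦ s ⟧ (E [ i ]≔ q)

    agree-transfer : ∀ {p q u v E E'} → T (δ p q u v) → (∀ j → ρ (E j) (E' j)) →
                     Agree p q E ⇔ Agree u v E'
    agree-transfer pquv E-ρ-E' = bridge-iff (eval-preserves₄ {δ} δ-sub s (δ-columns i pquv E-ρ-E'))

    agree-invariant : ∀ {p q} → SymClosure ρ p q → ∀ {E E'} → (∀ j → ρ (E j) (E' j)) →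
                      Agree p q E ⇔ Agree p q E'
    agree-invariant (fwd (_ , _ , pquv)) E-ρ-E' =
      ⇔.trans (agree-transfer pquv E-ρ-E') (⇔.sym (agree-transfer pquv (λ _ → ρ-refl)))
    agree-invariant (bwd q-ρ-p) E-ρ-E' =
      ⇔.trans (mk⇔ sym sym) (⇔.trans (agree-invariant (fwd q-ρ-p) E-ρ-E') (mk⇔ sym sym))

    term-condition : ∀ {p q} → SymClosure ρ p q → ∀ E → Agree p q E → Interchangeable s i p q
    term-condition {p} {q} p-q E agree E' =
      pointwise-invariant⇒constant ρ ρ-refl connected (Agree p q) agree-resp (agree-invariant p-q) E E' agree
      where
      agree-resp : Agree p q Respects _≗_
      agree-resp E≗E' agree = trans (eval-cong ext s (≔-pointwise {R = _≡_} i (sym ∘ E≗E') refl))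
                                (trans agree (eval-cong ext s (≔-pointwise {R = _≡_} i E≗E' refl)))

  leaving-edge : ∀ {B} → Nonempty 𝐀 B → Proper 𝐀 B → ∃₂ λ a b → a ∈ B × b ∉ B × SymClosure ρ a b
  leaving-edge {B} (a₀ , a₀∈B) proper with x , x∉B ← ¬∀⟶∃¬ size (_∈ B) (_∈? B) proper =
    boundary-edge (_∈? B) (connected a₀ x) a₀∈B x∉B

  module _ {B : Subset size} {b : A} where

    Substitute : ∀ {k} → Term 𝐀 (Fin k) → Fin k → Set
    Substitute s l = ∃ λ e → e ∈ B × Interchangeable s l e b

    module _ {a : A} (a∈B : a ∈ B) (a-b : SymClosure ρ a b) where

      refine : ∀ {k} (s : Term 𝐀 (Fin k)) → AbsorbsBy 𝐀 B s → ∀ j →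
        ∃ λ s' → AbsorbsBy 𝐀 B s' × Substitute s' j × (∀ {l} → l ≢ j → Substitute s l → Substitute s' l)
      refine {k} s s-abs j = s' , nest-absorbs ext s j s-abs N , (e , e∈B , e↔b) , preserve
        where
        open Endo A using (_^_)
        f : A → A
        f y = ⟦ s ⟧ (const a [ j ]≔ y)
        N : ℕ
        N = proj₁ (idempotent-iterate f b)
        s' : Term 𝐀 (Fin k)
        s' = nest s j (suc N)
        e : A
        e = (f ^ suc N) b
        e∈B : e ∈ B
        e∈B = s-abs j _ (λ j' j'≢j → ≔-elim (_∈ B) j' (⊥-elim ∘ j'≢j) (λ _ → a∈B))
        e-b : SymClosure ρ e b
        e-b = subst₂ (SymClosure ρ) (eval-nest ext s j (suc N) (const a) b) (eval-const-≔ ext idem s' j b)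
                (SymClosure.gmap (λ x → ⟦ s' ⟧ (const x [ j ]≔ b))
                  (λ x-ρ-y → eval-preserves-proj₁₂ {δ} δ-sub s' (≔-pointwise {R = ρ} j (λ _ → x-ρ-y) ρ-refl))
                  a-b)
        e↔b : Interchangeable s' j e b
        e↔b = term-condition s' j e-b (const a) (begin
          ⟦ s' ⟧ (const a [ j ]≔ e)  ≡⟨ eval-nest ext s j (suc N) (const a) e ⟩
          (f ^ suc N) e              ≡⟨ proj₂ (idempotent-iterate f b) ⟩
          e                          ≡⟨ eval-nest ext s j (suc N) (const a) b ⟨
          ⟦ s' ⟧ (const a [ j ]≔ b)  ∎)
          where open ≡-Reasoning
        preserve : ∀ {l} → l ≢ j → Substitute s l → Substitute s' l
        preserve l≢j (e' , e'∈B , e'↔b) = e' , e'∈B , nest-interchangeable ext s j l≢j e'↔b (suc N)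

      substitutes-on : ∀ {k} (t : Term 𝐀 (Fin k)) → AbsorbsBy 𝐀 B t → (ls : List (Fin k)) →
        ∃ λ s → AbsorbsBy 𝐀 B s × (∀ {l} → l ∈ₗ ls → Substitute s l)
      substitutes-on t t-abs [] = t , t-abs , λ ()
      substitutes-on t t-abs (j ∷ₗ ls)
        with s , s-abs , s-substitute ← substitutes-on t t-abs ls
        with s' , s'-abs , s'-substitute-j , preserve ← refine s s-abs j
        = s' , s'-abs , s'-substitute
        where
        s'-substitute : ∀ {l} → l ∈ₗ j ∷ₗ ls → Substitute s' l
        s'-substitute (here refl) = s'-substitute-j
        s'-substitute {l} (there l∈ls) with l ≟ j
        ... | yes refl = s'-substitute-j
        ... | no l≢j   = preserve l≢j (s-substitute l∈ls)

      substitutes : ∀ {k} (t : Term 𝐀 (Fin k)) → AbsorbsBy 𝐀 B t →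
        ∃ λ s → AbsorbsBy 𝐀 B s × (∀ l → Substitute s l)
      substitutes t t-abs with s , s-abs , s-substitute ← substitutes-on t t-abs (allFin _) =
        s , s-abs , λ l → s-substitute (∈-allFin l)

    substitute⇒∈ : ∀ (s : Term 𝐀 (Fin 2)) → AbsorbsBy 𝐀 B s → Substitute s zero → b ∈ B
    substitute⇒∈ s s-abs (e , e∈B , e↔b) =
      subst (_∈ B) (trans (e↔b (const b)) (eval-const-≔ ext idem s zero b))
        (s-abs (suc zero) (const b [ zero ]≔ e) λ { zero _ → e∈B ; (suc zero) 1≢1 → contradiction refl 1≢1 })

    substitutes⇒diagonal∈Sg² : ∀ {k} (s : Term 𝐀 (Fin k)) → (∀ l → Substitute s l) →
                              Sg² 𝐀 (crossGen 𝐀 b B) (b , b)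
    substitutes⇒diagonal∈Sg² s substitute =
      subst₂ (λ x y → Sg² 𝐀 (crossGen 𝐀 b B) (x , y)) (eval-const ext idem s b)
        (trans (eval-interchangeable ext s (proj₂ ∘ proj₂ ∘ substitute)) (eval-const ext idem s b))
        (eval-preserves-Sg² s (λ l → gen (inj₁ (refl , proj₁ (proj₂ (substitute l))))))

  not-binary-absorbing : ∀ B → ¬ (Nonempty 𝐀 B × Proper 𝐀 B × IsBinaryAbsorbing 𝐀 B)
  not-binary-absorbing B (nonempty , proper , _ , t , t-abs) =
    let _ , _ , a∈B , b∉B , a-b    = leaving-edge nonempty proper
        s , s-abs , substitute = substitutes a∈B a-b t t-abs
    in b∉B (substitute⇒∈ s s-abs (substitute zero))

  not-central : ∀ B → ¬ (Nonempty 𝐀 B × Proper 𝐀 B × IsCentral 𝐀 B)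
  not-central B (nonempty , proper , (_ , _ , t , t-abs) , central) =
    let _ , b , a∈B , b∉B , a-b = leaving-edge nonempty proper
        s , _ , substitute      = substitutes a∈B a-b t t-abs
    in central b b∉B (substitutes⇒diagonal∈Sg² s substitute)

lemma5p22 : (𝐀 : Algebra) → Idempotent 𝐀 → HasWNU 𝐀 →
    (δ : Rel4 𝐀) → IsBridge00 𝐀 δ →
    (∀ a b → proj₁₂ 𝐀 δ a b → δ̃ 𝐀 δ a b) →
    Linked 𝐀 (proj₁₂ 𝐀 δ) →
    BAandCenterFree 𝐀
lemma5p22 𝐀 idem _ δ bridge ρ⊆δ̃ linked = not-binary-absorbing , not-central
  where open Bridge 𝐀 idem δ bridge ρ⊆δ̃ linked
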